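{- Let $\Sigma$ be a time-complexity context and let $x_1,\dots,x_m$ be program variables of types $\sigma_1,\dots,\sigma_m$ not in the domain of $\Sigma$. Let $X$ be a time-complexity denotation with respect to $\Sigma$ extended by the time-complexity variables $x_{1c}\mathbin{:}\mathsf{T},x_{1p}\mathbin{:}\mathcal{P}(\sigma_1),\dots,x_{mc}\mathbin{:}\mathsf{T},x_{mp}\mathbin{:}\mathcal{P}(\sigma_m)$. Let $Y_1,\dots,Y_m$ be time-complexity denotations with respect to $\Sigma$, where $Y_i$ has values in $\mathbb{N}\times\mathcal{P}(\sigma_i)$. Then for every $\Sigma$-environment $\varrho$, \[ \bigl((\Lambda_\star x_1.\Lambda_\star x_2.\cdots\Lambda_\star x_m.X)\star Y_1\star\cdots\star Y_m\bigr)(\varrho) =\Bigl(2m+\sum_{i=1}^m \mathrm{cost}(Y_i\varrho)+\mathrm{cost}(X\varrho'),\ \mathrm{pot}(X\varrho')\Bigr), \] where $\varrho'=\varrho[x_1\mapsto \mathrm{val}(\mathrm{pot}(Y_1\varrho)),\dots,x_m\mapsto\mathrm{val}(\mathrm{pot}(Y_m\varrho))]$ and $\star$ associates to the left. Equivalently, the left-hand side equals $\varrho\mapsto\mathrm{dally}\bigl(2m+\sum_{i=1}^m\mathrm{cost}(Y_i\varrho),\,X\varrho'\bigr)$.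
   Context: Costs are natural numbers. For each program type $\sigma$ there is a potential space $\mathcal{P}(\sigma)$ and a time-complexity space $\mathcal{C}(\sigma)=\mathbb{N}\times\mathcal{P}(\sigma)$. For a base type, $\mathcal{P}(\sigma)=\mathbb{N}$. For an arrow type, $\mathcal{P}(\sigma\to\tau)$ consists of functions from $\mathcal{P}(\sigma)$ to $\mathcal{C}(\tau)$. For an element $\chi=(c,p)$ of a time-complexity space, $\mathrm{cost}(\chi)=c$ and $\mathrm{pot}(\chi)=p$. A time-complexity context $\Sigma$ assigns to finitely many time-complexity variables either the cost type $\mathsf{T}$ (interpreted as $\mathbb{N}$) or a potential type. A $\Sigma$-environment is a map sending each variable in $\mathrm{Dom}\,\Sigma$ to an element of the interpretation of its type. A time-complexity denotation of type $\mathcal{C}(\tau)$ with respect to $\Sigma$ is a function $X$ from $\Sigma$-environments to $\mathcal{C}(\tau)$. To each program variable $v$ of type $\sigma$ are associated two time-complexity variables, $v_c$ of type $\mathsf{T}$ and $v_p$ of type $\mathcal{P}(\sigma)$. Definitions: (i) For a potential $p$: if $p$ is of base type, $\mathrm{val}(p)=(\max(1,p),p)$; if $p$ is of arrow type, $\mathrm{val}(p)=(1,p)$. (ii) For a time-complexity $\chi$, the extended environment $\varrho[v\mapsto\chi]$ agrees with $\varrho$ except that $v_c\mapsto\mathrm{cost}(\chi)$ and $v_p\mapsto\mathrm{pot}(\chi)$. Simultaneous extensions are defined analogously. (iii) If $Y$ is a denotation of type $\mathcal{C}(\tau)$ with respect to $\Sigma$ extended by $v_c,v_p$ (with $v$ of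 type $\sigma$), then $\Lambda_\star v.Y$ is the denotation of type $\mathcal{C}(\sigma\to\tau)$ with respect to $\Sigma$ given by \[ (\Lambda_\star v.Y)(\varrho)=\bigl(1,\ q\mapsto Y(\varrho[v\mapsto\mathrm{val}(q)])\bigr). \] (iv) If $X$ has type $\mathcal{C}(\sigma\to\tau)$ and $Y$ has type $\mathcal{C}(\sigma)$, both with respect to $\Sigma$, then \[ (X\star Y)(\varrho)=\bigl(\mathrm{cost}(X\varrho)+\mathrm{cost}(Y\varrho)+\mathrm{cost}(\chi)+1,\ \mathrm{pot}(\chi)\bigr),\quad\text{where } \chi=\mathrm{pot}(X\varrho)(\mathrm{pot}(Y\varrho)). \] (v) $\mathrm{dally}(m,X)$ is the denotation $\varrho\mapsto\bigl(m+\mathrm{cost}(X\varrho),\ \mathrm{pot}(X\varrho)\bigr)$. -}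

module Defs where

open import Data.Nat using (ℕ; zero; suc; _+_; _*_; _⊔_)
open import Data.Product using (_×_; _,_; proj₁; proj₂)
open import Data.List using (List; []; _∷_)
open import Data.List.Relation.Unary.All using (All; []; _∷_)
open import Data.Vec using (Vec; []; _∷_)
import Data.Vec.Relation.Unary.All as VAll

data Ty : Set where
  base : Ty
  _⇒_  : Ty → Ty → Ty
infixr 5 _⇒_

mutual
  P : Ty → Set
  P base    = ℕ
  P (σ ⇒ τ) = P σ → C τ

  C : Ty → Set
  C σ = ℕ × P σ

cost : ∀ {σ} → C σ → ℕ
cost = proj₁

pot : ∀ {σ} → C σ → P σ
pot = proj₂

val : ∀ {σ} → P σ → C σ
val {base}  p = (1 ⊔ p , p)
val {_ ⇒ _} p = (1 , p)

data TcTy : Set where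
  T  : TcTy
  Pt : Ty → TcTy

⟦_⟧ : TcTy → Set
⟦ T ⟧    = ℕ
⟦ Pt σ ⟧ = P σ

-- Time-complexity contexts (variables are positions; freshness is automatic)
Ctx : Set
Ctx = List TcTy

Env : Ctx → Set
Env Σ = All ⟦_⟧ Σ

-- Σ extended by v_c : T, v_p : P(σ) for a fresh program variable v : σ
_,,_ : Ctx → Ty → Ctx
Σ ,, σ = Pt σ ∷ T ∷ Σ

extEnv : ∀ {Σ σ} → Env Σ → C σ → Env (Σ ,, σ)
extEnv ρ χ = pot χ ∷ cost χ ∷ ρ

Den : Ctx → Ty → Set
Den Σ τ = Env Σ → C τ

Λ⋆ : ∀ {Σ σ τ} → Den (Σ ,, σ) τ → Den Σ (σ ⇒ τ)
Λ⋆ Y ρ = (1 , λ q → Y (extEnv ρ (val q)))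

_⋆_ : ∀ {Σ σ τ} → Den Σ (σ ⇒ τ) → Den Σ σ → Den Σ τ
(X ⋆ Y) ρ =
  let χ = pot (X ρ) (pot (Y ρ)) in
  (cost (X ρ) + cost (Y ρ) + cost χ + 1 , pot χ)
infixl 6 _⋆_

dally : ∀ {Σ τ} → ℕ → Den Σ τ → Den Σ τ
dally m X ρ = (m + cost (X ρ) , pot (X ρ))

extAll : ∀ {m} → Ctx → Vec Ty m → Ctx
extAll Σ []       = Σ
extAll Σ (σ ∷ σs) = extAll (Σ ,, σ) σs

arrows : ∀ {m} → Vec Ty m → Ty → Ty
arrows []       τ = τ
arrows (σ ∷ σs) τ = σ ⇒ arrows σs τ

lams : ∀ {m Σ τ} (σs : Vec Ty m) → Den (extAll Σ σs) τ → Den Σ (arrows σs τ)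
lams []       X = X
lams (σ ∷ σs) X = Λ⋆ (lams σs X)

Dens : ∀ {m} → Ctx → Vec Ty m → Set
Dens Σ σs = VAll.All (Den Σ) σs

apps : ∀ {m Σ τ} {σs : Vec Ty m} → Den Σ (arrows σs τ) → Dens Σ σs → Den Σ τ
apps F VAll.[]       = F
apps F (Y VAll.∷ Ys) = apps (F ⋆ Y) Ys

sumCost : ∀ {m Σ} {σs : Vec Ty m} → Dens Σ σs → Env Σ → ℕ
sumCost VAll.[]       ρ = 0
sumCost (Y VAll.∷ Ys) ρ = cost (Y ρ) + sumCost Ys ρ

extEnvAll : ∀ {m Σ} {σs : Vec Ty m} → Env Σ → VAll.All C σs → Env (extAll Σ σs)
extEnvAll ρ VAll.[]       = ρ
extEnvAll ρ (χ VAll.∷ χs) = extEnvAll (extEnv ρ χ) χs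

valsOf : ∀ {m Σ} {σs : Vec Ty m} → Dens Σ σs → Env Σ → VAll.All C σs
valsOf VAll.[]       ρ = VAll.[]
valsOf (Y VAll.∷ Ys) ρ = val (pot (Y ρ)) VAll.∷ valsOf Ys ρ

module Submission where

-- Applying a (possibly dallied) abstraction is a β-step:
--   (dally(k, Λ⋆ v.Y) ⋆ Z)(ϱ) = dally(k + 2 + cost(Zϱ), Y)(ϱ₀[v ↦ val(pot(Zϱ))]),
-- where ϱ₀ is the environment the abstraction was evaluated in.  The two
-- extra cost units are the 1 paid for forming the abstraction and the 1 paid
-- for the application itself.  Iterating this over Y₁, …, Yₘ, each step
-- removes one Λ⋆ and adds 2 + cost(Yᵢϱ) to the accumulated delay, so
-- F ⋆ Y₁ ⋆ ⋯ ⋆ Yₘ behaves like dally(k + 2m + Σᵢ cost(Yᵢϱ), X)(ϱ₀′).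
-- Because the closure environment ϱ₀ differs from the environment ϱ of the
-- arguments after the first step, the iteration lemma keeps them apart and
-- is stated for any F whose value at ϱ is a dallied iterated abstraction.
-- Proposition 5.3 is its instance with delay 0 and ϱ₀ = ϱ.

open import Defs
open import Data.Nat using (ℕ; _+_; _*_; suc)
open import Data.Product using (_,_)
open import Data.Vec using (Vec; []; _∷_)
import Data.Vec.Relation.Unary.All as VAll
open import Relation.Binary.PropositionalEquality using (_≡_; refl; cong; trans)
open import Data.Nat.Tactic.RingSolver using (solve-∀)

β-dally : ∀ {Σ Σ₀ σ τ} (k : ℕ) (Y : Den (Σ₀ ,, σ) τ) (ρ₀ : Env Σ₀)
  (F : Den Σ (σ ⇒ τ)) (Z : Den Σ σ) (ρ : Env Σ) →
  F ρ ≡ dally k (Λ⋆ Y) ρ₀ →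
  (F ⋆ Z) ρ ≡ dally (k + 2 + cost (Z ρ)) Y (extEnv ρ₀ (val (pot (Z ρ))))
β-dally {Σ₀ = Σ₀} {σ = σ} k Y ρ₀ F Z ρ eq rewrite eq =
  cong (λ n → (n , pot (Y ρ₁))) (delay-shuffle k (cost (Z ρ)) (cost (Y ρ₁)))
  where
  ρ₁ : Env (Σ₀ ,, σ)
  ρ₁ = extEnv ρ₀ (val (pot (Z ρ)))
  delay-shuffle : ∀ k c d → k + 1 + c + d + 1 ≡ k + 2 + c + d
  delay-shuffle = solve-∀

apps-lams : ∀ {Σ Σ₀ m τ} (σs : Vec Ty m) (k : ℕ) (X : Den (extAll Σ₀ σs) τ)
  (ρ₀ : Env Σ₀) (F : Den Σ (arrows σs τ)) (Ys : Dens Σ σs) (ρ : Env Σ) →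
  F ρ ≡ dally k (lams σs X) ρ₀ →
  apps F Ys ρ ≡
    dally (k + 2 * m + sumCost Ys ρ) X (extEnvAll ρ₀ (valsOf Ys ρ))
apps-lams [] k X ρ₀ F VAll.[] ρ eq =
  trans eq (cong (λ n → dally n X ρ₀) (no-delay-added k))
  where
  no-delay-added : ∀ k → k ≡ k + 2 * 0 + 0
  no-delay-added = solve-∀
apps-lams {Σ₀ = Σ₀} {m = suc m} (σ ∷ σs) k X ρ₀ F (Y VAll.∷ Ys) ρ eq =
  trans (apps-lams σs (k + 2 + cost (Y ρ)) X ρ₁ (F ⋆ Y) Ys ρ
           (β-dally k (lams σs X) ρ₀ F Y ρ eq))
        (cong (λ n → dally n X (extEnvAll ρ₁ (valsOf Ys ρ)))
              (delay-collect k (cost (Y ρ)) m (sumCost Ys ρ)))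
  where
  ρ₁ : Env (Σ₀ ,, σ)
  ρ₁ = extEnv ρ₀ (val (pot (Y ρ)))
  delay-collect : ∀ k c m s → k + 2 + c + 2 * m + s ≡ k + 2 * suc m + (c + s)
  delay-collect = solve-∀

proposition5p3 : (Σ : Ctx) (m : ℕ) (σs : Vec Ty m) (τ : Ty)
    (X : Den (extAll Σ σs) τ) (Ys : Dens Σ σs) (ρ : Env Σ) →
    let ρ′ = extEnvAll ρ (valsOf Ys ρ) in
    apps (lams σs X) Ys ρ ≡ (2 * m + sumCost Ys ρ + cost (X ρ′) , pot (X ρ′))
proposition5p3 Σ m σs τ X Ys ρ = apps-lams σs 0 X ρ (lams σs X) Ys ρ refl
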